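{- Let $\mathbb{F}_q$ be a finite field, $a,b\in\mathbb{F}_q$ with $b\neq0$, and $Q=\begin{pmatrix} a & b\\ 1 & 0\end{pmatrix}$, and suppose $x^2-ax-b$ is irreducible over $\mathbb{F}_q$. Then every orbit length of $G=\langle Q\rangle$ acting on $\mathbb{F}_q\times\mathbb{F}_q$ is at most $2(q+1)|b^2|$, where $|b^2|$ is the multiplicative order of $b^2$ in $\mathbb{F}_q^\times$.
   Context: $G=\langle Q\rangle$ acts on $\mathbb{F}_q\times\mathbb{F}_q$ (column vectors) by $v\mapsto Q^nv$; orbit length is the number of elements of the orbit. -}

module Defs where

open import Level using (Level; _⊔_; suc)
open import Algebra.Bundles using (CommutativeRing)
open import Data.Nat using (ℕ; zero)
open import Data.Sum using (_⊎_)
import Data.Nat as Nat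
open import Data.Fin using (Fin)
open import Data.Product using (Σ; ∃; _×_; _,_)
open import Data.List using (List; length)
open import Data.List.Relation.Unary.All using (All)
open import Data.List.Relation.Unary.AllPairs using (AllPairs)
open import Relation.Binary.PropositionalEquality using (_≡_)
open import Relation.Nullary using (¬_)

record FiniteField (c ℓ : Level) : Set (suc (c ⊔ ℓ)) where
  field
    commRing : CommutativeRing c ℓ
  open CommutativeRing commRing public
  field
    0≉1      : ¬ (0# ≈ 1#)
    inverse  : ∀ x → ¬ (x ≈ 0#) → Σ Carrier λ y → x * y ≈ 1#
    q        : ℕ
    enum     : Fin q → Carrier
    enum-inj : ∀ i j → enum i ≈ enum j → i ≡ j
    enum-sur : ∀ x → ∃ λ i → enum i ≈ x

module _ {c ℓ} (F : FiniteField c ℓ) where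
  open FiniteField F

  pow : Carrier → ℕ → Carrier
  pow x zero = 1#
  pow x (Nat.suc n) = x * pow x n

  IsMulOrder : Carrier → ℕ → Set ℓ
  IsMulOrder x k = (1 Nat.≤ k) × (pow x k ≈ 1#)
                   × (∀ j → 1 Nat.≤ j → pow x j ≈ 1# → k Nat.≤ j)

  -- x² - a x - b is irreducible over F: it is not a product of two
  -- polynomials of degree 1, (c₁x + c₀)(d₁x + d₀), compared coefficientwise.
  IrreducibleQuadratic : Carrier → Carrier → Set (c ⊔ ℓ)
  IrreducibleQuadratic a b =
    ¬ (Σ Carrier λ c₁ → Σ Carrier λ c₀ → Σ Carrier λ d₁ → Σ Carrier λ d₀ →
         ¬ (c₁ ≈ 0#) × ¬ (d₁ ≈ 0#)
         × (c₁ * d₁ ≈ 1#)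
         × (c₁ * d₀ + c₀ * d₁ ≈ - a)
         × (c₀ * d₀ ≈ - b))

  Vec2 : Set c
  Vec2 = Carrier × Carrier

  _≈₂_ : Vec2 → Vec2 → Set ℓ
  (x , y) ≈₂ (x' , y') = (x ≈ x') × (y ≈ y')

  Qmul : Carrier → Carrier → Vec2 → Vec2
  Qmul a b (x , y) = (a * x + b * y , 1# * x + 0# * y)

  Qpow : Carrier → Carrier → ℕ → Vec2 → Vec2
  Qpow a b zero v = v
  Qpow a b (Nat.suc n) v = Qmul a b (Qpow a b n v)

  -- w lies in the orbit of v under G = ⟨Q⟩.  (Since Q is invertible of
  -- finite order, negative powers give nothing new; we nevertheless allow
  -- them: w = Q^{-n} v iff Q^n w = v.)
  InOrbit : Carrier → Carrier → Vec2 → Vec2 → Set ℓ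
  InOrbit a b v w = ∃ λ (n : ℕ) → (Qpow a b n v ≈₂ w) ⊎ (Qpow a b n w ≈₂ v)

  -- "the orbit of v has at most N elements": every list of pairwise
  -- distinct elements of the orbit has length ≤ N.
  OrbitLengthAtMost : Carrier → Carrier → Vec2 → ℕ → Set (c ⊔ ℓ)
  OrbitLengthAtMost a b v N =
    (L : List Vec2) → AllPairs (λ u w → ¬ (u ≈₂ w)) L →
    All (InOrbit a b v) L → length L Nat.≤ N

-- The form N(x , y) = x² − a x y − b y² is anisotropic, because X² − a X − b has no root, and
-- N(Q v) = −b N(v).  As (−b)^(2k) = (b²)^k = 1, every point w of the orbit of v has an exponent
-- i < 2k with N(Qⁱ w) = N(v), and w ↦ (i , Qⁱ w) is injective.  A level set of an anisotropic
-- binary form has at most q + 1 points: a line through one of its points p meets it in at most one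
-- further point, so projecting from p (sending p to its tangent) embeds it in the projective line.

module Submission where

open import Defs
open import Level using (_⊔_)
open import Algebra.Bundles using (CommutativeRing; Semiring)
open import Algebra.Solver.Ring.AlmostCommutativeRing
  using (fromCommutativeRing; _-Raw-AlmostCommutative⟶_)
open import Data.Empty using (⊥-elim)
open import Data.Fin as Fin using (Fin; fromℕ; inject₁; toℕ; combine)
import Data.Fin.Properties as Fin
open import Data.Integer as ℤ using (ℤ; +_; -[1+_]; _⊖_; _◃_; sign; ∣_∣)
import Data.Integer.Properties as ℤ
open import Data.List using (length)
open import Data.List.Membership.Propositional.Properties using (∈-lookup)
open import Data.List.Relation.Unary.All as All using (All; []; _∷_)
open import Data.List.Relation.Unary.AllPairs using (AllPairs; []; _∷_)
open import Data.Maybe as Maybe using (Maybe)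
open import Data.Nat as ℕ using (ℕ; zero; suc; NonZero)
import Data.Nat.Properties as ℕ
open import Data.Nat.DivMod using (_mod_; _divMod_; DivMod)
open import Data.Nat.Tactic.RingSolver using (solve-∀)
open import Data.Product using (Σ; _,_; proj₁; proj₂)
open import Data.Sign as Sign using (Sign)
open import Data.Sum using (_⊎_; inj₁; inj₂)
open import Function.Definitions using (Injective)
open import Relation.Binary.Consequences using (dec⇒weaklyDec)
open import Relation.Binary.Core using (Rel)
open import Relation.Binary.PropositionalEquality as ≡ using (_≡_)
open import Relation.Nullary using (¬_; Dec; yes; no)
open import Relation.Unary using (Pred)

module ℤ-CoefficientSolver {c ℓ} (R : CommutativeRing c ℓ) where
  open CommutativeRing R
  open import Algebra.Properties.Semiring.Mult semiring
    using (×-homo-+; ×1-homo-*) renaming (_×_ to _·_)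
  open import Algebra.Properties.Ring ring using (-‿distribˡ-*; -‿distribʳ-*)
  open import Algebra.Properties.AbelianGroup +-abelianGroup using (⁻¹-∙-comm)
  open import Algebra.Properties.Group +-group using (ε⁻¹≈ε; ⁻¹-involutive)
  open import Relation.Binary.Reasoning.Setoid setoid

  fromℤ : ℤ → Carrier
  fromℤ (+ n)    = n · 1#
  fromℤ -[1+ n ] = - (suc n · 1#)

  signed : Sign → Carrier → Carrier
  signed Sign.+ x = x
  signed Sign.- x = - x

  signed-cong : ∀ s {x y} → x ≈ y → signed s x ≈ signed s y
  signed-cong Sign.+ x≈y = x≈y
  signed-cong Sign.- x≈y = -‿cong x≈y

  signed-* : ∀ s t x y → signed (s Sign.* t) (x * y) ≈ signed s x * signed t y
  signed-* Sign.+ Sign.+ x y = refl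
  signed-* Sign.+ Sign.- x y = -‿distribʳ-* x y
  signed-* Sign.- Sign.+ x y = -‿distribˡ-* x y
  signed-* Sign.- Sign.- x y = begin
    x * y         ≈⟨ ⁻¹-involutive (x * y) ⟨
    - - (x * y)   ≈⟨ -‿cong (-‿distribˡ-* x y) ⟩
    - (- x * y)   ≈⟨ -‿distribʳ-* (- x) y ⟩
    - x * - y     ∎

  fromℤ-◃ : ∀ s n → fromℤ (s ◃ n) ≈ signed s (n · 1#)
  fromℤ-◃ Sign.+ zero    = refl
  fromℤ-◃ Sign.- zero    = sym ε⁻¹≈ε
  fromℤ-◃ Sign.+ (suc n) = refl
  fromℤ-◃ Sign.- (suc n) = refl

  fromℤ-sign-abs : ∀ i → fromℤ i ≈ signed (sign i) (∣ i ∣ · 1#)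
  fromℤ-sign-abs (+ n)    = refl
  fromℤ-sign-abs -[1+ n ] = refl

  fromℤ-* : ∀ i j → fromℤ (i ℤ.* j) ≈ fromℤ i * fromℤ j
  fromℤ-* i j = begin
    fromℤ (s ◃ (∣ i ∣ ℕ.* ∣ j ∣))                 ≈⟨ fromℤ-◃ s (∣ i ∣ ℕ.* ∣ j ∣) ⟩
    signed s ((∣ i ∣ ℕ.* ∣ j ∣) · 1#)             ≈⟨ signed-cong s (×1-homo-* ∣ i ∣ ∣ j ∣) ⟩
    signed s ((∣ i ∣ · 1#) * (∣ j ∣ · 1#))        ≈⟨ signed-* (sign i) (sign j) _ _ ⟩
    signed (sign i) (∣ i ∣ · 1#) * signed (sign j) (∣ j ∣ · 1#)
                                                  ≈⟨ *-cong (fromℤ-sign-abs i) (fromℤ-sign-abs j) ⟨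
    fromℤ i * fromℤ j                             ∎
    where
    s : Sign
    s = sign i Sign.* sign j

  1+x-[1+y]≈x-y : ∀ x y → (1# + x) + - (1# + y) ≈ x + - y
  1+x-[1+y]≈x-y x y = begin
    (1# + x) + - (1# + y)     ≈⟨ +-cong (+-comm x 1#) (⁻¹-∙-comm 1# y) ⟨
    (x + 1#) + (- 1# + - y)   ≈⟨ +-assoc x 1# _ ⟩
    x + (1# + (- 1# + - y))   ≈⟨ +-congˡ (+-assoc 1# (- 1#) (- y)) ⟨
    x + ((1# + - 1#) + - y)   ≈⟨ +-congˡ (+-congʳ (-‿inverseʳ 1#)) ⟩
    x + (0# + - y)            ≈⟨ +-congˡ (+-identityˡ (- y)) ⟩
    x + - y                   ∎

  fromℤ-⊖ : ∀ m n → fromℤ (m ⊖ n) ≈ m · 1# + - (n · 1#)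
  fromℤ-⊖ m       zero    = sym (trans (+-congˡ ε⁻¹≈ε) (+-identityʳ _))
  fromℤ-⊖ zero    (suc n) = sym (+-identityˡ _)
  fromℤ-⊖ (suc m) (suc n) = begin
    fromℤ (suc m ⊖ suc n)           ≡⟨ ≡.cong fromℤ (ℤ.[1+m]⊖[1+n]≡m⊖n m n) ⟩
    fromℤ (m ⊖ n)                   ≈⟨ fromℤ-⊖ m n ⟩
    m · 1# + - (n · 1#)             ≈⟨ 1+x-[1+y]≈x-y _ _ ⟨
    suc m · 1# + - (suc n · 1#)     ∎

  fromℤ-+ : ∀ i j → fromℤ (i ℤ.+ j) ≈ fromℤ i + fromℤ j
  fromℤ-+ (+ m)    (+ n)    = ×-homo-+ 1# m n
  fromℤ-+ (+ m)    -[1+ n ] = fromℤ-⊖ m (suc n)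
  fromℤ-+ -[1+ m ] (+ n)    = trans (fromℤ-⊖ n (suc m)) (+-comm _ _)
  fromℤ-+ -[1+ m ] -[1+ n ] = begin
    - (suc (suc (m ℕ.+ n)) · 1#)      ≡⟨ ≡.cong (λ k → - (k · 1#)) (ℕ.+-suc (suc m) n) ⟨
    - ((suc m ℕ.+ suc n) · 1#)        ≈⟨ -‿cong (×-homo-+ 1# (suc m) (suc n)) ⟩
    - (suc m · 1# + suc n · 1#)       ≈⟨ ⁻¹-∙-comm _ _ ⟨
    - (suc m · 1#) + - (suc n · 1#)   ∎

  fromℤ-neg : ∀ i → fromℤ (ℤ.- i) ≈ - fromℤ i
  fromℤ-neg (+ zero)  = sym ε⁻¹≈ε
  fromℤ-neg (+ suc n) = refl
  fromℤ-neg -[1+ n ]  = sym (⁻¹-involutive _)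

  fromℤ-homomorphism : ℤ.+-*-rawRing -Raw-AlmostCommutative⟶ fromCommutativeRing R
  fromℤ-homomorphism = record
    { ⟦_⟧    = fromℤ
    ; +-homo = fromℤ-+
    ; *-homo = fromℤ-*
    ; -‿homo = fromℤ-neg
    ; 0-homo = refl
    ; 1-homo = +-identityʳ 1#
    }

  fromℤ-weaklyDecidable : ∀ i j → Maybe (fromℤ i ≈ fromℤ j)
  fromℤ-weaklyDecidable i j = Maybe.map (λ { ≡.refl → refl }) (dec⇒weaklyDec ℤ._≟_ i j)

  open import Algebra.Solver.Ring
    ℤ.+-*-rawRing (fromCommutativeRing R) fromℤ-homomorphism fromℤ-weaklyDecidable public

module _ {a ℓ} (S : Semiring a ℓ) where
  open Semiring S
  open import Algebra.Properties.Semiring.Exp S using (_^_; ^-homo-*)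
  open import Relation.Binary.Reasoning.Setoid setoid

  module _ {x : Carrier} {P : ℕ} .{{_ : NonZero P}} (x^P≈1 : x ^ P ≈ 1#) where

    ^-*-period : ∀ m → x ^ (m ℕ.* P) ≈ 1#
    ^-*-period zero    = refl
    ^-*-period (suc m) = begin
      x ^ (P ℕ.+ m ℕ.* P)       ≈⟨ ^-homo-* x P (m ℕ.* P) ⟩
      x ^ P * x ^ (m ℕ.* P)     ≈⟨ *-cong x^P≈1 (^-*-period m) ⟩
      1# * 1#                   ≈⟨ *-identityˡ 1# ⟩
      1#                        ∎

    ^-mod-period : ∀ n → x ^ n ≈ x ^ toℕ (n mod P)
    ^-mod-period n = begin
      x ^ n                              ≡⟨ ≡.cong (x ^_) property ⟩
      x ^ (toℕ remainder ℕ.+ quotient ℕ.* P)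
                                         ≈⟨ ^-homo-* x (toℕ remainder) (quotient ℕ.* P) ⟩
      x ^ toℕ remainder * x ^ (quotient ℕ.* P)
                                         ≈⟨ *-congˡ (^-*-period quotient) ⟩
      x ^ toℕ remainder * 1#             ≈⟨ *-identityʳ _ ⟩
      x ^ toℕ remainder                  ∎
      where open DivMod (n divMod P)

    ^-mod-inverse : ∀ n → x ^ n * x ^ toℕ ((n ℕ.* ℕ.pred P) mod P) ≈ 1#
    ^-mod-inverse n = begin
      x ^ n * x ^ toℕ ((n ℕ.* ℕ.pred P) mod P)  ≈⟨ *-congˡ (^-mod-period (n ℕ.* ℕ.pred P)) ⟨
      x ^ n * x ^ (n ℕ.* ℕ.pred P)              ≈⟨ ^-homo-* x n (n ℕ.* ℕ.pred P) ⟨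
      x ^ (n ℕ.+ n ℕ.* ℕ.pred P)                ≡⟨ ≡.cong (x ^_) n+n*[P-1]≡n*P ⟩
      x ^ (n ℕ.* P)                             ≈⟨ ^-*-period n ⟩
      1#                                        ∎
      where
      n+n*[P-1]≡n*P : n ℕ.+ n ℕ.* ℕ.pred P ≡ n ℕ.* P
      n+n*[P-1]≡n*P = ≡.trans (≡.sym (ℕ.*-suc n (ℕ.pred P))) (≡.cong (n ℕ.*_) (ℕ.suc-pred P))

module _ {a ℓ p} {A : Set a} (_~_ : Rel A ℓ) {P : Pred A p} {M : ℕ}
         (code : ∀ {x} → P x → Fin M)
         (code-injective : ∀ {x y} (px : P x) (py : P y) → code px ≡ code py → x ~ y)
         where

  private
    codeAt : ∀ {xs} → All P xs → Fin (length xs) → Fin M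
    codeAt pxs i = code (All.lookup pxs (∈-lookup i))

    codeAt-injective : ∀ {xs} (pxs : All P xs) → AllPairs (λ x y → ¬ x ~ y) xs →
                       Injective _≡_ _≡_ (codeAt pxs)
    codeAt-injective (_ ∷ _)   (_ ∷ _)        {Fin.zero}  {Fin.zero}  _  = ≡.refl
    codeAt-injective (_ ∷ _)   (x≁xs ∷ _)     {Fin.zero}  {Fin.suc j} eq =
      ⊥-elim (All.lookup x≁xs (∈-lookup j) (code-injective _ _ eq))
    codeAt-injective (_ ∷ _)   (x≁xs ∷ _)     {Fin.suc i} {Fin.zero}  eq =
      ⊥-elim (All.lookup x≁xs (∈-lookup i) (code-injective _ _ (≡.sym eq)))
    codeAt-injective (_ ∷ pxs) (_ ∷ distinct) {Fin.suc i} {Fin.suc j} eq =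
      ≡.cong Fin.suc (codeAt-injective pxs distinct eq)

  distinct-length≤ : ∀ {xs} → AllPairs (λ x y → ¬ x ~ y) xs → All P xs → length xs ℕ.≤ M
  distinct-length≤ distinct pxs = Fin.injective⇒≤ (codeAt-injective pxs distinct)

module FiniteFieldProperties {c ℓ} (F : FiniteField c ℓ) where
  open FiniteField F
  open ℤ-CoefficientSolver commRing using (solve; _:=_; _:+_; _:-_; _:*_; :-_; con; Polynomial)
  open import Algebra.Properties.Group +-group using (ε⁻¹≈ε; x∙y⁻¹≈ε⇒x≈y; ∙-cancelˡ; ∙-cancelʳ)
  open import Algebra.Properties.Semiring.Exp semiring public using (_^_; ^-congˡ; ^-assocʳ)
  open import Relation.Binary.Reasoning.Setoid setoid

  index : Carrier → Fin q
  index x = proj₁ (enum-sur x)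

  index-injective : ∀ {x y} → index x ≡ index y → x ≈ y
  index-injective {x} {y} eq = begin
    x                 ≈⟨ proj₂ (enum-sur x) ⟨
    enum (index x)    ≡⟨ ≡.cong enum eq ⟩
    enum (index y)    ≈⟨ proj₂ (enum-sur y) ⟩
    y                 ∎

  _≟_ : ∀ x y → Dec (x ≈ y)
  x ≟ y with index x Fin.≟ index y
  ... | yes eq  = yes (index-injective eq)
  ... | no x≢y = no λ x≈y → x≢y (enum-inj _ _
    (trans (proj₂ (enum-sur x)) (trans x≈y (sym (proj₂ (enum-sur y))))))

  inv : ∀ x → ¬ x ≈ 0# → Carrier
  inv x x≉0 = proj₁ (inverse x x≉0)

  *-inv : ∀ x (x≉0 : ¬ x ≈ 0#) → x * inv x x≉0 ≈ 1#
  *-inv x x≉0 = proj₂ (inverse x x≉0)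

  *-inv-cancelʳ : ∀ y x (x≉0 : ¬ x ≈ 0#) → (y * inv x x≉0) * x ≈ y
  *-inv-cancelʳ y x x≉0 = begin
    (y * inv x x≉0) * x   ≈⟨ solve 3 (λ y x x⁻¹ → (y :* x⁻¹) :* x := y :* (x :* x⁻¹)) refl y x (inv x x≉0) ⟩
    y * (x * inv x x≉0)   ≈⟨ *-congˡ (*-inv x x≉0) ⟩
    y * 1#                ≈⟨ *-identityʳ y ⟩
    y                     ∎

  *-cancelˡ : ∀ {x y z} → ¬ x ≈ 0# → x * y ≈ x * z → y ≈ z
  *-cancelˡ {x} {y} {z} x≉0 xy≈xz = begin
    y                       ≈⟨ *-inv-cancelʳ y x x≉0 ⟨
    (y * inv x x≉0) * x     ≈⟨ solve 3 (λ y x⁻¹ x → (y :* x⁻¹) :* x := x⁻¹ :* (x :* y)) refl y (inv x x≉0) x ⟩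
    inv x x≉0 * (x * y)     ≈⟨ *-congˡ xy≈xz ⟩
    inv x x≉0 * (x * z)     ≈⟨ solve 3 (λ z x⁻¹ x → x⁻¹ :* (x :* z) := (z :* x⁻¹) :* x) refl z (inv x x≉0) x ⟩
    (z * inv x x≉0) * x     ≈⟨ *-inv-cancelʳ z x x≉0 ⟩
    z                       ∎

  *-cancelʳ : ∀ {x y z} → ¬ x ≈ 0# → y * x ≈ z * x → y ≈ z
  *-cancelʳ x≉0 yx≈zx = *-cancelˡ x≉0 (trans (*-comm _ _) (trans yx≈zx (*-comm _ _)))

  x*y≈0⇒y≈0 : ∀ {x y} → ¬ x ≈ 0# → x * y ≈ 0# → y ≈ 0#
  x*y≈0⇒y≈0 x≉0 xy≈0 = *-cancelˡ x≉0 (trans xy≈0 (sym (zeroʳ _)))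

  x*x≈0⇒x≈0 : ∀ {x} → x * x ≈ 0# → x ≈ 0#
  x*x≈0⇒x≈0 {x} xx≈0 with x ≟ 0#
  ... | yes x≈0 = x≈0
  ... | no x≉0  = x*y≈0⇒y≈0 x≉0 xx≈0

  pow≡^ : ∀ x n → pow F x n ≡ x ^ n
  pow≡^ x zero    = ≡.refl
  pow≡^ x (suc n) = ≡.cong (x *_) (pow≡^ x n)

  [-x]^[2*k]≈[x*x]^k : ∀ x k → (- x) ^ (2 ℕ.* k) ≈ (x * x) ^ k
  [-x]^[2*k]≈[x*x]^k x k = begin
    (- x) ^ (2 ℕ.* k)     ≈⟨ ^-assocʳ (- x) 2 k ⟨
    ((- x) ^ 2) ^ k       ≈⟨ ^-congˡ k (*-congˡ (*-identityʳ (- x))) ⟩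
    (- x * - x) ^ k       ≈⟨ ^-congˡ k (solve 1 (λ x → :- x :* :- x := x :* x) refl x) ⟩
    (x * x) ^ k           ∎

  infix 4 _≈ᵥ_ _≟ᵥ_
  infixl 6 _+ᵥ_ _-ᵥ_
  infixr 7 _·ᵥ_

  _≈ᵥ_ : Vec2 F → Vec2 F → Set ℓ
  _≈ᵥ_ = _≈₂_ F

  ≈ᵥ-sym : ∀ {u v} → u ≈ᵥ v → v ≈ᵥ u
  ≈ᵥ-sym (x≈x' , y≈y') = sym x≈x' , sym y≈y'

  ≈ᵥ-trans : ∀ {u v w} → u ≈ᵥ v → v ≈ᵥ w → u ≈ᵥ w
  ≈ᵥ-trans (x≈x' , y≈y') (x'≈x'' , y'≈y'') = trans x≈x' x'≈x'' , trans y≈y' y'≈y''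

  _≟ᵥ_ : ∀ u v → Dec (u ≈ᵥ v)
  (x , y) ≟ᵥ (x' , y') with x ≟ x' | y ≟ y'
  ... | yes x≈x' | yes y≈y' = yes (x≈x' , y≈y')
  ... | no x≉x'  | _        = no λ u≈v → x≉x' (proj₁ u≈v)
  ... | yes _    | no y≉y'  = no λ u≈v → y≉y' (proj₂ u≈v)

  0ᵥ : Vec2 F
  0ᵥ = 0# , 0#

  _+ᵥ_ : Vec2 F → Vec2 F → Vec2 F
  (x , y) +ᵥ (x' , y') = x + x' , y + y'

  _-ᵥ_ : Vec2 F → Vec2 F → Vec2 F
  (x , y) -ᵥ (x' , y') = x + - x' , y + - y'

  _·ᵥ_ : Carrier → Vec2 F → Vec2 F
  s ·ᵥ (x , y) = s * x , s * y

  -ᵥ≈0⇒≈ : ∀ {u v} → u -ᵥ v ≈ᵥ 0ᵥ → u ≈ᵥ v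
  -ᵥ≈0⇒≈ (dx≈0 , dy≈0) = x∙y⁻¹≈ε⇒x≈y _ _ dx≈0 , x∙y⁻¹≈ε⇒x≈y _ _ dy≈0

  -ᵥ≈⇒≈+ᵥ : ∀ {u v d} → u -ᵥ v ≈ᵥ d → u ≈ᵥ v +ᵥ d
  -ᵥ≈⇒≈+ᵥ {x , y} {x₀ , y₀} (dx , dy) = move x x₀ dx , move y y₀ dy
    where
    move : ∀ x x₀ {t} → x + - x₀ ≈ t → x ≈ x₀ + t
    move x x₀ x-x₀≈t = trans (solve 2 (λ x x₀ → x := x₀ :+ (x :- x₀)) refl x x₀) (+-congˡ x-x₀≈t)

  det : Vec2 F → Vec2 F → Carrier
  det (x , y) (x' , y') = x * y' + - (y * x')

  det-cong : ∀ {u u' v v'} → u ≈ᵥ u' → v ≈ᵥ v' → det u v ≈ det u' v'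
  det-cong (x≈ , y≈) (x'≈ , y'≈) = +-cong (*-cong x≈ y'≈) (-‿cong (*-cong y≈ x'≈))

  -- The points of the projective line over F: the slope x/y, or ∞ = fromℕ q when y ≈ 0.
  direction : Vec2 F → Fin (suc q)
  direction (x , y) with y ≟ 0#
  ... | yes _   = fromℕ q
  ... | no y≉0 = inject₁ (index (x * inv y y≉0))

  direction-proportional : ∀ {d d'} → ¬ d ≈ᵥ 0ᵥ → direction d ≡ direction d' →
                           Σ Carrier λ s → d' ≈ᵥ s ·ᵥ d
  direction-proportional {x , y} {x' , y'} d≉0 eq with y ≟ 0# | y' ≟ 0#
  ... | yes y≈0 | yes y'≈0 = s , sym (*-inv-cancelʳ x' x x≉0) , y'≈s*y
    where
    x≉0 : ¬ x ≈ 0#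
    x≉0 x≈0 = d≉0 (x≈0 , y≈0)
    s : Carrier
    s = x' * inv x x≉0
    y'≈s*y : y' ≈ s * y
    y'≈s*y = trans y'≈0 (trans (sym (zeroʳ s)) (*-congˡ (sym y≈0)))
  ... | yes _ | no _ = ⊥-elim (Fin.fromℕ≢inject₁ eq)
  ... | no _  | yes _ = ⊥-elim (Fin.fromℕ≢inject₁ (≡.sym eq))
  ... | no y≉0 | no y'≉0 = s , sym s*x≈x' , sym (*-inv-cancelʳ y' y y≉0)
    where
    s : Carrier
    s = y' * inv y y≉0
    s*x≈x' : s * x ≈ x'
    s*x≈x' = begin
      (y' * inv y y≉0) * x     ≈⟨ solve 3 (λ y' y⁻¹ x → (y' :* y⁻¹) :* x := y' :* (x :* y⁻¹)) refl y' (inv y y≉0) x ⟩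
      y' * (x * inv y y≉0)     ≈⟨ *-congˡ (index-injective (Fin.inject₁-injective eq)) ⟩
      y' * (x' * inv y' y'≉0)  ≈⟨ *-comm y' _ ⟩
      (x' * inv y' y'≉0) * y'  ≈⟨ *-inv-cancelʳ x' y' y'≉0 ⟩
      x'                       ∎

  det-direction : ∀ {d d'} → direction d ≡ direction d' → det d d' ≈ 0#
  det-direction {d} {d'} eq with d ≟ᵥ 0ᵥ
  ... | yes d≈0 = trans (det-cong d≈0 (refl , refl))
                        (solve 2 (λ x' y' → con (+ 0) :* y' :- con (+ 0) :* x' := con (+ 0)) refl _ _)
  ... | no d≉0 with direction-proportional d≉0 eq
  ...   | s , d'≈sd = trans (det-cong (refl , refl) d'≈sd)
                        (solve 3 (λ x y s → x :* (s :* y) :- y :* (s :* x) := con (+ 0)) refl _ _ s)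

  module NormForm (a b : Carrier) where

    form : Vec2 F → Carrier
    form (x , y) = x * x + - (a * (x * y)) + - (b * (y * y))

    formᴾ : ∀ {n} → Polynomial n → Polynomial n → Polynomial n → Polynomial n → Polynomial n
    formᴾ a b x y = x :* x :- a :* (x :* y) :- b :* (y :* y)

    form-cong : ∀ {u v} → u ≈ᵥ v → form u ≈ form v
    form-cong (x≈ , y≈) =
      +-cong (+-cong (*-cong x≈ x≈) (-‿cong (*-congˡ (*-cong x≈ y≈)))) (-‿cong (*-congˡ (*-cong y≈ y≈)))

    Anisotropic : Set (c ⊔ ℓ)
    Anisotropic = ∀ u → form u ≈ 0# → u ≈ᵥ 0ᵥ

    irreducible⇒no-root : IrreducibleQuadratic F a b → ∀ r → ¬ r * r + - (a * r) + - b ≈ 0#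
    irreducible⇒no-root irr r root =
      irr (1# , - r , 1# , r + - a , 1≉0 , 1≉0 , *-identityˡ 1# , linear , constant)
      where
      1≉0 : ¬ 1# ≈ 0#
      1≉0 1≈0 = 0≉1 (sym 1≈0)
      linear : 1# * (r + - a) + - r * 1# ≈ - a
      linear = trans (+-cong (*-identityˡ _) (*-identityʳ _)) (solve 2 (λ r a → (r :- a) :- r := :- a) refl r a)
      constant : - r * (r + - a) ≈ - b
      constant = begin
        - r * (r + - a)                     ≈⟨ solve 3 (λ a b r → :- r :* (r :- a) := :- (r :* r :- a :* r :- b) :- b) refl a b r ⟩
        - (r * r + - (a * r) + - b) + - b   ≈⟨ +-congʳ (-‿cong root) ⟩
        - 0# + - b                          ≈⟨ +-congʳ ε⁻¹≈ε ⟩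
        0# + - b                            ≈⟨ +-identityˡ _ ⟩
        - b                                 ∎

    irreducible⇒anisotropic : IrreducibleQuadratic F a b → Anisotropic
    irreducible⇒anisotropic irr (x , y) form≈0 with y ≟ 0#
    ... | yes y≈0 = x*x≈0⇒x≈0 x*x≈0 , y≈0
      where
      x*x≈0 : x * x ≈ 0#
      x*x≈0 = begin
        x * x          ≈⟨ solve 3 (λ a b x → x :* x := formᴾ a b x (con (+ 0))) refl a b x ⟩
        form (x , 0#)  ≈⟨ form-cong (refl , sym y≈0) ⟩
        form (x , y)   ≈⟨ form≈0 ⟩
        0#             ∎
    ... | no y≉0 = ⊥-elim (irreducible⇒no-root irr r (x*y≈0⇒y≈0 y*y≉0 y²[r²-ar-b]≈0))
      where
      r : Carrier
      r = x * inv y y≉0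
      y*y≉0 : ¬ y * y ≈ 0#
      y*y≉0 y*y≈0 = y≉0 (x*x≈0⇒x≈0 y*y≈0)
      y²[r²-ar-b]≈0 : (y * y) * (r * r + - (a * r) + - b) ≈ 0#
      y²[r²-ar-b]≈0 = begin
        (y * y) * (r * r + - (a * r) + - b)
          ≈⟨ solve 4 (λ a b r y → (y :* y) :* (r :* r :- a :* r :- b) := formᴾ a b (r :* y) y) refl a b r y ⟩
        form (r * y , y)   ≈⟨ form-cong (*-inv-cancelʳ x y y≉0 , refl) ⟩
        form (x , y)       ≈⟨ form≈0 ⟩
        0#                 ∎

    Q : Vec2 F → Vec2 F
    Q = Qmul F a b

    Q^ : ℕ → Vec2 F → Vec2 F
    Q^ = Qpow F a b

    1*x+0*y≈x : ∀ x y → 1# * x + 0# * y ≈ x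
    1*x+0*y≈x x y = trans (+-cong (*-identityˡ x) (zeroˡ y)) (+-identityʳ x)

    form-Q : ∀ v → form (Q v) ≈ - b * form v
    form-Q (x , y) = begin
      form (a * x + b * y , 1# * x + 0# * y)   ≈⟨ form-cong (refl , 1*x+0*y≈x x y) ⟩
      form (a * x + b * y , x)
        ≈⟨ solve 4 (λ a b x y → formᴾ a b (a :* x :+ b :* y) x := :- b :* formᴾ a b x y) refl a b x y ⟩
      - b * form (x , y)                       ∎

    form-Q^ : ∀ n v → form (Q^ n v) ≈ (- b) ^ n * form v
    form-Q^ zero    v = sym (*-identityˡ _)
    form-Q^ (suc n) v = begin
      form (Q (Q^ n v))            ≈⟨ form-Q (Q^ n v) ⟩
      - b * form (Q^ n v)          ≈⟨ *-congˡ (form-Q^ n v) ⟩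
      - b * ((- b) ^ n * form v)   ≈⟨ *-assoc _ _ _ ⟨
      (- b) ^ suc n * form v       ∎

    Q-injective : ¬ b ≈ 0# → ∀ {u v} → Q u ≈ᵥ Q v → u ≈ᵥ v
    Q-injective b≉0 {x , y} {x' , y'} (first≈ , second≈) = x≈x' , *-cancelˡ b≉0 by≈by'
      where
      x≈x' : x ≈ x'
      x≈x' = trans (sym (1*x+0*y≈x x y)) (trans second≈ (1*x+0*y≈x x' y'))
      by≈by' : b * y ≈ b * y'
      by≈by' = ∙-cancelˡ (a * x) _ _ (trans first≈ (+-congʳ (*-congˡ (sym x≈x'))))

    Q^-injective : ¬ b ≈ 0# → ∀ n {u v} → Q^ n u ≈ᵥ Q^ n v → u ≈ᵥ v
    Q^-injective b≉0 zero    Qⁿu≈Qⁿv = Qⁿu≈Qⁿv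
    Q^-injective b≉0 (suc n) Qⁿu≈Qⁿv = Q^-injective b≉0 n (Q-injective b≉0 Qⁿu≈Qⁿv)

    tangent : Vec2 F → Vec2 F
    tangent (x₀ , y₀) = a * x₀ + (b * y₀ + b * y₀) , (x₀ + x₀) + - (a * y₀)

    -- d ↦ det d (tangent p) is the polarisation of form at p.
    form-on-line : ∀ p s d → form (p +ᵥ s ·ᵥ d) ≈ form p + s * (det d (tangent p) + s * form d)
    form-on-line (x₀ , y₀) s (dx , dy) = solve 7
      (λ a b x₀ y₀ s dx dy →
        formᴾ a b (x₀ :+ s :* dx) (y₀ :+ s :* dy)
        := formᴾ a b x₀ y₀ :+ s :* ((dx :* ((x₀ :+ x₀) :- a :* y₀) :- dy :* (a :* x₀ :+ (b :* y₀ :+ b :* y₀)))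
                                    :+ s :* formᴾ a b dx dy))
      refl a b x₀ y₀ s dx dy

    level-set-on-line : ∀ {p u s d} → u ≈ᵥ p +ᵥ s ·ᵥ d → form u ≈ form p →
                        s ≈ 0# ⊎ det d (tangent p) + s * form d ≈ 0#
    level-set-on-line {p} {u} {s} {d} u≈p+sd level with s ≟ 0#
    ... | yes s≈0 = inj₁ s≈0
    ... | no s≉0  = inj₂ (x*y≈0⇒y≈0 s≉0 (∙-cancelˡ (form p) _ _ (begin
      form p + s * (det d (tangent p) + s * form d)   ≈⟨ form-on-line p s d ⟨
      form (p +ᵥ s ·ᵥ d)                              ≈⟨ form-cong u≈p+sd ⟨
      form u                                          ≈⟨ level ⟩
      form p                                          ≈⟨ +-identityʳ (form p) ⟨
      form p + 0#                                     ∎)))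

    chord : ∀ {p u} → form u ≈ form p → det (u -ᵥ p) (tangent p) + 1# * form (u -ᵥ p) ≈ 0#
    chord level with level-set-on-line (-ᵥ≈⇒≈+ᵥ (sym (*-identityˡ _) , sym (*-identityˡ _))) level
    ... | inj₁ 1≈0 = ⊥-elim (0≉1 (sym 1≈0))
    ... | inj₂ chord≈0 = chord≈0

    module _ (anisotropic : Anisotropic) {p : Vec2 F} where

      tangent-not-chord : ∀ {u} → ¬ u ≈ᵥ p → form u ≈ form p → ¬ det (u -ᵥ p) (tangent p) ≈ 0#
      tangent-not-chord {u} u≉p level det≈0 = u≉p (-ᵥ≈0⇒≈ (anisotropic (u -ᵥ p) (begin
        form (u -ᵥ p)                                   ≈⟨ *-identityˡ _ ⟨
        1# * form (u -ᵥ p)                              ≈⟨ +-identityˡ _ ⟨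
        0# + 1# * form (u -ᵥ p)                         ≈⟨ +-congʳ det≈0 ⟨
        det (u -ᵥ p) (tangent p) + 1# * form (u -ᵥ p)   ≈⟨ chord level ⟩
        0#                                              ∎)))

      chords-injective : ∀ {u u'} → ¬ u ≈ᵥ p → ¬ u' ≈ᵥ p → form u ≈ form p → form u' ≈ form p →
                         direction (u -ᵥ p) ≡ direction (u' -ᵥ p) → u ≈ᵥ u'
      chords-injective {u} {u'} u≉p u'≉p level level' eq
        with s , u'-p≈s·d ← direction-proportional (λ d≈0 → u≉p (-ᵥ≈0⇒≈ d≈0)) eq
        with level-set-on-line (-ᵥ≈⇒≈+ᵥ u'-p≈s·d) level'
      ... | inj₁ s≈0 = ⊥-elim (u'≉p (-ᵥ≈0⇒≈ (≈ᵥ-trans u'-p≈s·d (s·d≈0 _ , s·d≈0 _))))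
        where
        s·d≈0 : ∀ x → s * x ≈ 0#
        s·d≈0 x = trans (*-congʳ s≈0) (zeroˡ x)
      ... | inj₂ chord'≈0 = ∙-cancelʳ (- proj₁ p) _ _ (trans (d≈s·d _) (sym (proj₁ u'-p≈s·d)))
                          , ∙-cancelʳ (- proj₂ p) _ _ (trans (d≈s·d _) (sym (proj₂ u'-p≈s·d)))
        where
        d : Vec2 F
        d = u -ᵥ p
        form-d≉0 : ¬ form d ≈ 0#
        form-d≉0 form-d≈0 = u≉p (-ᵥ≈0⇒≈ (anisotropic d form-d≈0))
        s≈1 : s ≈ 1#
        s≈1 = *-cancelʳ form-d≉0 (∙-cancelˡ (det d (tangent p)) _ _ (trans chord'≈0 (sym (chord level))))
        d≈s·d : ∀ x → x ≈ s * x
        d≈s·d x = sym (trans (*-congʳ s≈1) (*-identityˡ x))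

    -- Projection of the level set of p from p onto the projective line; p itself goes to its
    -- tangent direction.
    conicCode : Vec2 F → Vec2 F → Fin (suc q)
    conicCode p u with u ≟ᵥ p
    ... | yes _ = direction (tangent p)
    ... | no _  = direction (u -ᵥ p)

    conicCode-injective : Anisotropic → ∀ {p u u'} → form u ≈ form p → form u' ≈ form p →
                          conicCode p u ≡ conicCode p u' → u ≈ᵥ u'
    conicCode-injective anisotropic {p} {u} {u'} level level' eq with u ≟ᵥ p | u' ≟ᵥ p
    ... | yes u≈p | yes u'≈p = ≈ᵥ-trans u≈p (≈ᵥ-sym u'≈p)
    ... | yes _   | no u'≉p  = ⊥-elim (tangent-not-chord anisotropic u'≉p level' (det-direction (≡.sym eq)))
    ... | no u≉p  | yes _    = ⊥-elim (tangent-not-chord anisotropic u≉p level (det-direction eq))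
    ... | no u≉p  | no u'≉p  = chords-injective anisotropic u≉p u'≉p level level' eq

    module Orbit (b≉0 : ¬ b ≈ 0#) (anisotropic : Anisotropic)
                 {P : ℕ} .{{_ : NonZero P}} ([-b]^P≈1 : (- b) ^ P ≈ 1#) (v : Vec2 F) where

      ReturnTime : Vec2 F → Set ℓ
      ReturnTime w = Σ (Fin P) λ i → form (Q^ (toℕ i) w) ≈ form v

      returnTime : ∀ {w} → InOrbit F a b v w → ReturnTime w
      returnTime {w} (n , inj₁ Qⁿv≈w) = i , (begin
        form (Q^ (toℕ i) w)                    ≈⟨ form-Q^ (toℕ i) w ⟩
        (- b) ^ toℕ i * form w                 ≈⟨ *-congˡ (form-cong (≈ᵥ-sym Qⁿv≈w)) ⟩
        (- b) ^ toℕ i * form (Q^ n v)          ≈⟨ *-congˡ (form-Q^ n v) ⟩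
        (- b) ^ toℕ i * ((- b) ^ n * form v)   ≈⟨ solve 3 (λ x y z → x :* (y :* z) := (y :* x) :* z) refl _ _ _ ⟩
        ((- b) ^ n * (- b) ^ toℕ i) * form v   ≈⟨ *-congʳ (^-mod-inverse semiring [-b]^P≈1 n) ⟩
        1# * form v                            ≈⟨ *-identityˡ _ ⟩
        form v                                 ∎)
        where
        i : Fin P
        i = (n ℕ.* ℕ.pred P) mod P
      returnTime {w} (n , inj₂ Qⁿw≈v) = n mod P , (begin
        form (Q^ (toℕ (n mod P)) w)      ≈⟨ form-Q^ (toℕ (n mod P)) w ⟩
        (- b) ^ toℕ (n mod P) * form w   ≈⟨ *-congʳ (^-mod-period semiring [-b]^P≈1 n) ⟨
        (- b) ^ n * form w               ≈⟨ form-Q^ n w ⟨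
        form (Q^ n w)                    ≈⟨ form-cong Qⁿw≈v ⟩
        form v                           ∎)

      orbitCode : ∀ {w} → ReturnTime w → Fin (P ℕ.* suc q)
      orbitCode {w} (i , _) = combine i (conicCode v (Q^ (toℕ i) w))

      orbitCode-injective : ∀ {w w'} (r : ReturnTime w) (r' : ReturnTime w') →
                            orbitCode r ≡ orbitCode r' → w ≈ᵥ w'
      orbitCode-injective (i , level) (i' , level') eq with Fin.combine-injective i _ i' _ eq
      ... | ≡.refl , eq' = Q^-injective b≉0 (toℕ i) (conicCode-injective anisotropic level level' eq')

      orbit-length≤ : OrbitLengthAtMost F a b v (P ℕ.* suc q)
      orbit-length≤ _ distinct inOrbit =
        distinct-length≤ _≈ᵥ_ orbitCode orbitCode-injective distinct (All.map returnTime inOrbit)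

2k[q+1]≡2[q+1]k : ∀ k q → 2 ℕ.* k ℕ.* suc q ≡ 2 ℕ.* (q ℕ.+ 1) ℕ.* k
2k[q+1]≡2[q+1]k = solve-∀

mainTheorem19 : ∀ {c ℓ} (F : FiniteField c ℓ) (a b : FiniteField.Carrier F) →
    ¬ (FiniteField._≈_ F b (FiniteField.0# F)) →
    IrreducibleQuadratic F a b →
    ∀ (k : ℕ) → IsMulOrder F (FiniteField._*_ F b b) k →
    ∀ (v : Vec2 F) → OrbitLengthAtMost F a b v (2 ℕ.* (FiniteField.q F ℕ.+ 1) ℕ.* k)
mainTheorem19 F a b b≉0 irr zero      (() , _)
mainTheorem19 F a b b≉0 irr k@(suc _) (_ , [b*b]^k≈1 , _) v =
  ≡.subst (OrbitLengthAtMost F a b v) (2k[q+1]≡2[q+1]k k q) orbit-length≤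
  where
  open FiniteField F
  open FiniteFieldProperties F
  open NormForm a b
  [-b]^[2k]≈1 : (- b) ^ (2 ℕ.* k) ≈ 1#
  [-b]^[2k]≈1 = trans ([-x]^[2*k]≈[x*x]^k b k) (≡.subst (_≈ 1#) (pow≡^ (b * b) k) [b*b]^k≈1)
  open Orbit b≉0 (irreducible⇒anisotropic irr) {P = 2 ℕ.* k} [-b]^[2k]≈1 v
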